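{- Let $r,k,\ell$ be positive integers, let $G$ be a hypergraph on $n\geq k$ vertices all of whose edges have size at most $r$, and let $c$ be a real number with $32^2 r\leq c<\sqrt{k}/2$. Let $z=\frac{1}{32r}c$ and $p=1-\frac{1}{8r}$. Then for every $k$-vertex subset $A\subseteq V(G)$ with $e(A)=\ell$ and $c\leq m(A)\leq \sqrt{k}/2$ the following holds: if a subset $B\subseteq A$ is chosen randomly by including each element of $A$ into $B$ independently with probability $p$, then with probability at least $\frac14$ the pair $(A,B)$ is $z$-nice.
   Context: A hypergraph has a finite vertex set and edges which are non-empty subsets of the vertex set. For $W\subseteq V(G)$, $e(W)$ is the number of edges $e\subseteq W$; a vertex $v\in W$ is non-isolated in $W$ if some edge $e\subseteq W$ contains $v$, and $m(W)$ is the number of non-isolated vertices of $W$. For $B\subseteq V(G)$, a vertex $v\in V(G)\setminus B$ is connected to $B$ if there is an edge $e$ with $v\in e$ and $e\setminus\{v\}\subseteq B$. For $B\subseteq A\subseteq V(G)$: $h(A,B)$ is the number of $v\in A\setminus B$ connected to $B$; $m(A,B)$ is the number of $v\in A\setminus B$ non-isolated in $A$; $f(A,B)=m(A,B)-h(A,B)$. A pair $(A,B)$ with $B\subseteq A\subseteq V(G)$ is $z$-nice if: (i) $|A|=k$ and $e(A)=\ell$; (ii) $z\leq h(A,B)\leq \sqrt{k}/2$; (iii) $|A\setminus B|\geq 2\sqrt{k}\cdot f(A,B)$; (iv) $|A\setminus B|\geq \sqrt{k}$.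
   Formalization: The parameter c ranges over the rationals instead of the reals. -}

module Defs where

open import Data.Bool using (Bool; true; false; if_then_else_)
open import Data.Nat as ℕ using (ℕ; zero; suc)
import Data.Nat.Properties as ℕP
open import Data.Integer as ℤ using (ℤ; +_)
import Data.Integer.Properties as ℤP
open import Data.Rational as ℚ using (ℚ; 0ℚ; 1ℚ; _/_)
import Data.Rational.Properties as ℚP
open import Data.Fin using (Fin)
open import Data.Fin.Subset using (Subset; inside; outside; _∈_; _∉_; _⊆_; _─_; _-_; ∣_∣; Nonempty)
open import Data.Fin.Subset.Properties using (_∈?_; _⊆?_)
open import Data.Vec using (_∷_; [])
open import Data.List using (List; []; _∷_; map; _++_; filter; length; allFin)
open import Data.List.Relation.Unary.All using (All)
open import Data.List.Relation.Unary.Any using (Any; any?)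
open import Data.List.Relation.Unary.Unique.Propositional using (Unique)
open import Data.Product using (_×_; _,_)
open import Data.Sum using (_⊎_)
open import Relation.Nullary using (Dec; ¬_; does)
open import Relation.Nullary.Decidable using (_×-dec_; _⊎-dec_; ¬?)

record Hypergraph : Set where
  field
    n        : ℕ
    edges    : List (Subset n)
    unique   : Unique edges
    nonempty : All Nonempty edges

open Hypergraph public

module _ (G : Hypergraph) where

  private
    V = Fin (n G)

  count : {P : V → Set} → ((v : V) → Dec (P v)) → ℕ
  count P? = length (filter P? (allFin (n G)))

  e : Subset (n G) → ℕ
  e W = length (filter (_⊆? W) (edges G))

  NonIsolated : Subset (n G) → V → Set
  NonIsolated W v = v ∈ W × Any (λ ed → ed ⊆ W × v ∈ ed) (edges G)

  nonIsolated? : (W : Subset (n G)) (v : V) → Dec (NonIsolated W v)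
  nonIsolated? W v = (v ∈? W) ×-dec any? (λ ed → (ed ⊆? W) ×-dec (v ∈? ed)) (edges G)

  m : Subset (n G) → ℕ
  m W = count (nonIsolated? W)

  Connected : Subset (n G) → V → Set
  Connected B v = v ∉ B × Any (λ ed → v ∈ ed × (ed - v) ⊆ B) (edges G)

  connected? : (B : Subset (n G)) (v : V) → Dec (Connected B v)
  connected? B v = ¬? (v ∈? B) ×-dec any? (λ ed → (v ∈? ed) ×-dec ((ed - v) ⊆? B)) (edges G)

  h : Subset (n G) → Subset (n G) → ℕ
  h A B = count (λ v → ((v ∈? A) ×-dec ¬? (v ∈? B)) ×-dec connected? B v)

  mAB : Subset (n G) → Subset (n G) → ℕ
  mAB A B = count (λ v → ((v ∈? A) ×-dec ¬? (v ∈? B)) ×-dec nonIsolated? A v)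

  f : Subset (n G) → Subset (n G) → ℤ
  f A B = + mAB A B ℤ.- + h A B

-- x ≤ √k / 2   for x : ℕ   (x ≥ 0, so  ⟺  4x² ≤ k)
LeHalfSqrt : ℕ → ℕ → Set
LeHalfSqrt x k = 4 ℕ.* (x ℕ.* x) ℕ.≤ k

-- c < √k / 2   for c : ℚ   (⟺  c < 0  or  4c² < k)
LtHalfSqrtℚ : ℚ → ℕ → Set
LtHalfSqrtℚ c k = c ℚ.< 0ℚ ⊎ (+ 4 / 1) ℚ.* (c ℚ.* c) ℚ.< (+ k / 1)

-- 2 √k · f ≤ x   for f : ℤ, x : ℕ   (x ≥ 0, so  ⟺  f ≤ 0  or  4 k f² ≤ x²)
TwoSqrtMulLe : ℕ → ℤ → ℕ → Set
TwoSqrtMulLe k fv x = fv ℤ.≤ + 0 ⊎ + (4 ℕ.* k) ℤ.* (fv ℤ.* fv) ℤ.≤ + (x ℕ.* x)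

-- √k ≤ x   for x : ℕ   (⟺  k ≤ x²)
SqrtLe : ℕ → ℕ → Set
SqrtLe k x = k ℕ.≤ x ℕ.* x

-- z-nice pairs (z : ℚ). (B ⊆ A is imposed where pairs are considered.)

module _ (G : Hypergraph) (k ℓ : ℕ) (z : ℚ) where

  Nice : Subset (n G) → Subset (n G) → Set
  Nice A B =
      (∣ A ∣ ≡ k × e G A ≡ ℓ)
    × (z ℚ.≤ (+ h G A B / 1) × LeHalfSqrt (h G A B) k)
    × TwoSqrtMulLe k (f G A B) ∣ A ─ B ∣
    × SqrtLe k ∣ A ─ B ∣
    where open import Relation.Binary.PropositionalEquality using (_≡_)

  nice? : (A B : Subset (n G)) → Dec (Nice A B)
  nice? A B =
      ((∣ A ∣ ℕ.≟ k) ×-dec (e G A ℕ.≟ ℓ))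
    ×-dec ((z ℚ.≤? (+ h G A B / 1)) ×-dec (4 ℕ.* (h G A B ℕ.* h G A B) ℕ.≤? k))
    ×-dec ((f G A B ℤ.≤? + 0) ⊎-dec (+ (4 ℕ.* k) ℤ.* (f G A B ℤ.* f G A B) ℤ.≤? + (∣ A ─ B ∣ ℕ.* ∣ A ─ B ∣)))
    ×-dec (k ℕ.≤? ∣ A ─ B ∣ ℕ.* ∣ A ─ B ∣)

allSubsets : (n : ℕ) → List (Subset n)
allSubsets zero    = [] ∷ []
allSubsets (suc n) = map (inside ∷_) (allSubsets n) ++ map (outside ∷_) (allSubsets n)

_^ℚ_ : ℚ → ℕ → ℚ
q ^ℚ zero  = 1ℚ
q ^ℚ suc j = q ℚ.* (q ^ℚ j)

sumℚ : List ℚ → ℚ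
sumℚ []       = 0ℚ
sumℚ (x ∷ xs) = x ℚ.+ sumℚ xs

-- Pr[ P(B) ] where B ⊆ A is random with P(v ∈ B) = p independently for v ∈ A:
-- the sum over all B ⊆ A satisfying P of  p^|B| (1-p)^|A∖B|.
prob : {N : ℕ} (p : ℚ) (A : Subset N) {P : Subset N → Set} → ((B : Subset N) → Dec (P B)) → ℚ
prob {N} p A P? =
  sumℚ (map (λ B → (p ^ℚ ∣ B ∣) ℚ.* ((1ℚ ℚ.- p) ^ℚ ∣ A ─ B ∣))
            (filter (λ B → (B ⊆? A) ×-dec P? B) (allSubsets N)))

-- Parameters of the lemma (r ≥ 1 is assumed in the lemma; the value at
-- r = 0 is irrelevant).

pOf : ℕ → ℚ
pOf zero    = 1ℚ
pOf (suc r) = 1ℚ ℚ.- (+ 1 / (8 ℕ.* suc r))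

zOf : ℕ → ℚ → ℚ
zOf zero    c = 0ℚ
zOf (suc r) c = c ℚ.* (+ 1 / (32 ℕ.* suc r))

-- Write D = 8r = a + 1, so that B keeps each vertex of A with probability a/D; then
-- D^|A| times an expectation over B is a natural number, and every estimate becomes an
-- inequality between natural numbers. Three events are rare:
--  * fewer than half the expected number of vertices of A are missing from B, and
--  * fewer than half the expected number of non-isolated vertices are missing from B
--    (each has probability ≤ 1/32 by Chebyshev, the variance being a/D² per vertex);
--  * the defect, which counts for each non-isolated v ∉ B the other vertices of one fixed edge
--    at v that also miss B, exceeds m(A)/4D (probability ≤ 1/2 by Markov, as a pair of vertices
--    misses B with probability 1/D²).
-- Since m(A,B) ≤ h(A,B) + defect, outside these events (A,B) is z-nice, which therefore happens
-- with probability at least 1 - 1/32 - 1/32 - 1/2 ≥ 1/4.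
module Submission where

open import Data.Bool using (Bool; true; false; not; _∧_; if_then_else_)
open import Data.Fin using (Fin; zero; suc)
open import Data.Fin.Properties using () renaming (_≟_ to _≟ᶠ_)
open import Data.Fin.Subset using (Subset; inside; outside; _∈_; _∉_; _⊆_; ∣_∣; _─_; _-_; ⁅_⁆) renaming (⊥ to ∅)
open import Data.Fin.Subset.Properties using (_∈?_; _⊆?_; in⊆in; out⊆; p─q⊆p; x∈p∧x≢y⇒x∈p-y; x∉⁅y⁆⇒x≢y)
open import Data.Integer as ℤ using (+_)
import Data.Integer.Properties as ℤ
import Data.Integer.Tactic.RingSolver as ℤ
open import Data.List using (List; []; _∷_; map; _++_; filter; length; tabulate)
open import Data.List.Membership.Propositional using (find; lose)
open import Data.List.Properties using (map-++; map-∘)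
open import Data.List.Relation.Unary.All as All using (All)
open import Data.List.Relation.Unary.Any as Any using (Any)
open import Data.Nat as ℕ hiding (_/_)
open import Data.Nat.Coprimality as Coprime using (1-coprimeTo)
open import Data.Nat.Properties
open import Algebra.Properties.CommutativeSemigroup *-commutativeSemigroup using (x∙yz≈y∙xz)
open import Data.Nat.Tactic.RingSolver using (solve-∀)
open import Data.Product using (_×_; _,_; proj₁)
open import Data.Rational as ℚ using (ℚ; mkℚ; _/_; 0ℚ; 1ℚ; toℚᵘ) renaming (_≤_ to _≤ℚ_)
import Data.Rational.Properties as ℚ
open import Data.Rational.Solver using (module +-*-Solver)
import Data.Rational.Unnormalised as ℚᵘ
import Data.Rational.Unnormalised.Properties as ℚᵘ
open import Data.Sum using (inj₂; [_,_]′)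
open import Data.Vec using ([]; _∷_; lookup; here; there)
open import Data.Vec.Properties using ([]=⇒lookup; lookup⇒[]=)
open import Function using (_∘_)
open import Relation.Binary.PropositionalEquality
open import Relation.Nullary using (Dec; yes; no; does; ¬_; contradiction)
open import Relation.Nullary.Decidable using (_×-dec_; ¬?)
open import Defs
open import Algebra.Properties.Semiring.Sum +-*-semiring
  using (sum; sum-cong-≗; sum-replicate-zero; ∑-distrib-+; *-distribˡ-sum; *-distribʳ-sum)

𝟙 : Bool → ℕ
𝟙 true  = 1
𝟙 false = 0

𝟙-idem : ∀ b → 𝟙 b * 𝟙 b ≡ 𝟙 b
𝟙-idem true  = refl
𝟙-idem false = refl

sum-mono : ∀ {N} {f g : Fin N → ℕ} → (∀ v → f v ≤ g v) → sum f ≤ sum g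
sum-mono {zero}  f≤g = z≤n
sum-mono {suc N} f≤g = +-mono-≤ (f≤g zero) (sum-mono (f≤g ∘ suc))

sum≡0⇒≡0 : ∀ {N} (f : Fin N → ℕ) → sum f ≡ 0 → ∀ v → f v ≡ 0
sum≡0⇒≡0 f eq zero    = m+n≡0⇒m≡0 (f zero) eq
sum≡0⇒≡0 f eq (suc v) = sum≡0⇒≡0 (f ∘ suc) (m+n≡0⇒n≡0 (f zero) eq) v

sum-*ʳ : ∀ {N} (f : Fin N → ℕ) c → sum (λ v → f v * c) ≡ sum f * c
sum-*ʳ f c = sym (*-distribʳ-sum c f)

sum-≟ : ∀ {N} (u : Fin N) → sum (λ v → 𝟙 (does (u ≟ᶠ v))) ≡ 1
sum-≟ {suc N} zero = cong suc (sum-replicate-zero N)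
sum-≟ (suc u)      = sum-≟ u

length-filter-tabulate : ∀ {A : Set} {P : A → Set} (P? : ∀ x → Dec (P x)) {N} (f : Fin N → A) →
  length (filter P? (tabulate f)) ≡ sum (λ v → 𝟙 (does (P? (f v))))
length-filter-tabulate P? {zero}  f = refl
length-filter-tabulate P? {suc N} f with does (P? (f zero))
... | true  = cong suc (length-filter-tabulate P? (f ∘ suc))
... | false = length-filter-tabulate P? (f ∘ suc)

∣p∣≡sum : ∀ {N} (p : Subset N) → ∣ p ∣ ≡ sum (λ v → 𝟙 (lookup p v))
∣p∣≡sum []            = refl
∣p∣≡sum (inside ∷ p)  = cong suc (∣p∣≡sum p)
∣p∣≡sum (outside ∷ p) = ∣p∣≡sum p

𝟙∉ : ∀ {N} → Fin N → Subset N → ℕ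
𝟙∉ v p = 𝟙 (not (lookup p v))

∣p─q∣≡sum : ∀ {N} (p q : Subset N) → ∣ p ─ q ∣ ≡ sum (λ v → 𝟙 (lookup p v) * 𝟙∉ v q)
∣p─q∣≡sum []            []            = refl
∣p─q∣≡sum (x ∷ p)       (inside ∷ q)  = trans (∣p─q∣≡sum p q) (cong (_+ sum (λ v → 𝟙 (lookup p v) * 𝟙∉ v q)) (sym (*-zeroʳ (𝟙 x))))
∣p─q∣≡sum (inside ∷ p)  (outside ∷ q) = cong suc (∣p─q∣≡sum p q)
∣p─q∣≡sum (outside ∷ p) (outside ∷ q) = ∣p─q∣≡sum p q

x∉p⇒lookup≡false : ∀ {N} {v : Fin N} {p} → v ∉ p → lookup p v ≡ false
x∉p⇒lookup≡false {v = v} {p} v∉p with lookup p v in lookup≡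
... | true  = contradiction (lookup⇒[]= v p lookup≡) v∉p
... | false = refl

x∈p─q⇒x∉q : ∀ {N} {v : Fin N} (p q : Subset N) → v ∈ p ─ q → v ∉ q
x∈p─q⇒x∉q (_ ∷ p) (outside ∷ q) here       ()
x∈p─q⇒x∉q (_ ∷ p) (_ ∷ q)       (there v∈) (there v∈q) = x∈p─q⇒x∉q p q v∈ v∈q

𝟙∉≡0⇒∈ : ∀ {N} (v : Fin N) (p : Subset N) → 𝟙∉ v p ≡ 0 → v ∈ p
𝟙∉≡0⇒∈ v p eq with lookup p v in lookup≡
... | true  = lookup⇒[]= v p lookup≡
𝟙∉≡0⇒∈ v p () | false

𝟙*𝟙≤𝟙 : ∀ b c → 𝟙 b * 𝟙 c ≤ 𝟙 b
𝟙*𝟙≤𝟙 b true  = ≤-reflexive (*-identityʳ (𝟙 b))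
𝟙*𝟙≤𝟙 b false = ≤-trans (≤-reflexive (*-zeroʳ (𝟙 b))) z≤n

does≡true⇒ : ∀ {P : Set} (P? : Dec P) → does P? ≡ true → P
does≡true⇒ (yes p) _ = p

-- 𝔼 A g = ∑_{B ⊆ A} a^∣B∣ g(B) is (a+1)^∣A∣ times the expectation of g(B) for the random
-- subset B ⊆ A containing each element independently with probability a/(a+1).
module SubsetSum (a : ℕ) where

  D : ℕ
  D = suc a

  𝔼 : ∀ {N} → Subset N → (Subset N → ℕ) → ℕ
  𝔼 []            g = g []
  𝔼 (inside ∷ A)  g = a * 𝔼 A (g ∘ (inside ∷_)) + 𝔼 A (g ∘ (outside ∷_))
  𝔼 (outside ∷ A) g = 𝔼 A (g ∘ (outside ∷_))

  𝔼-cong : ∀ {N} (A : Subset N) {g h : Subset N → ℕ} → (∀ B → g B ≡ h B) → 𝔼 A g ≡ 𝔼 A h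
  𝔼-cong []            g≡h = g≡h []
  𝔼-cong (inside ∷ A)  g≡h = cong₂ (λ x y → a * x + y) (𝔼-cong A (g≡h ∘ _)) (𝔼-cong A (g≡h ∘ _))
  𝔼-cong (outside ∷ A) g≡h = 𝔼-cong A (g≡h ∘ _)

  𝔼-mono : ∀ {N} (A : Subset N) {g h : Subset N → ℕ} → (∀ B → B ⊆ A → g B ≤ h B) → 𝔼 A g ≤ 𝔼 A h
  𝔼-mono []            g≤h = g≤h [] (λ x → x)
  𝔼-mono (inside ∷ A)  g≤h =
    +-mono-≤ (*-monoʳ-≤ a (𝔼-mono A (λ B → g≤h _ ∘ in⊆in))) (𝔼-mono A (λ B → g≤h _ ∘ out⊆))
  𝔼-mono (outside ∷ A) g≤h = 𝔼-mono A (λ B → g≤h _ ∘ out⊆)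

  𝔼-+ : ∀ {N} (A : Subset N) (g h : Subset N → ℕ) → 𝔼 A (λ B → g B + h B) ≡ 𝔼 A g + 𝔼 A h
  𝔼-+ []            g h = refl
  𝔼-+ (inside ∷ A)  g h
    rewrite 𝔼-+ A (g ∘ (inside ∷_)) (h ∘ (inside ∷_)) | 𝔼-+ A (g ∘ (outside ∷_)) (h ∘ (outside ∷_)) =
      shuffle a _ _ _ _
      where
      shuffle : ∀ a x y z w → a * (x + y) + (z + w) ≡ (a * x + z) + (a * y + w)
      shuffle = solve-∀
  𝔼-+ (outside ∷ A) g h = 𝔼-+ A _ _

  𝔼-* : ∀ {N} (A : Subset N) c (g : Subset N → ℕ) → 𝔼 A (λ B → c * g B) ≡ c * 𝔼 A g
  𝔼-* []            c g = refl
  𝔼-* (inside ∷ A)  c g rewrite 𝔼-* A c (g ∘ (inside ∷_)) | 𝔼-* A c (g ∘ (outside ∷_)) = shuffle a c _ _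
    where
    shuffle : ∀ a c x y → a * (c * x) + c * y ≡ c * (a * x + y)
    shuffle = solve-∀
  𝔼-* (outside ∷ A) c g = 𝔼-* A c _

  𝔼-const : ∀ {N} (A : Subset N) c → 𝔼 A (λ _ → c) ≡ c * D ^ ∣ A ∣
  𝔼-const []            c = sym (*-identityʳ c)
  𝔼-const (inside ∷ A)  c rewrite 𝔼-const A c = shuffle a c (D ^ ∣ A ∣)
    where
    shuffle : ∀ a c t → a * (c * t) + c * t ≡ c * (suc a * t)
    shuffle = solve-∀
  𝔼-const (outside ∷ A) c = 𝔼-const A c

  𝔼-sum : ∀ {N M} (A : Subset N) (g : Fin M → Subset N → ℕ) →
          𝔼 A (λ B → sum (λ v → g v B)) ≡ sum (λ v → 𝔼 A (g v))
  𝔼-sum {M = zero}  A g = 𝔼-const A 0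
  𝔼-sum {M = suc M} A g = trans (𝔼-+ A (g zero) (λ B → sum (λ v → g (suc v) B)))
                                (cong (_+_ (𝔼 A (g zero))) (𝔼-sum A (g ∘ suc)))

  𝔼-one : ∀ {N} (A : Subset N) → 𝔼 A (λ _ → 1) ≡ D ^ ∣ A ∣
  𝔼-one A = trans (𝔼-const A 1) (*-identityˡ (D ^ ∣ A ∣))

  𝔼-𝟙∉ : ∀ {N} (A : Subset N) u → lookup A u ≡ true → D * 𝔼 A (𝟙∉ u) ≡ D ^ ∣ A ∣
  𝔼-𝟙∉ (inside ∷ A)  zero    _   rewrite 𝔼-const A 0 | 𝔼-one A | *-zeroʳ a = refl
  𝔼-𝟙∉ (inside ∷ A)  (suc u) u∈A = cong (D *_) (trans (+-comm (a * E) E) (𝔼-𝟙∉ A u u∈A))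
    where E = 𝔼 A (𝟙∉ u)
  𝔼-𝟙∉ (outside ∷ A) (suc u) u∈A = 𝔼-𝟙∉ A u u∈A

  𝔼-𝟙∉-pair : ∀ {N} (A : Subset N) {u v} → u ≢ v → lookup A u ≡ true → lookup A v ≡ true →
              D * (D * 𝔼 A (λ B → 𝟙∉ u B * 𝟙∉ v B)) ≡ D ^ ∣ A ∣
  𝔼-𝟙∉-pair A {zero} {zero} u≢v _ _ = contradiction refl u≢v
  𝔼-𝟙∉-pair (inside ∷ A) {zero} {suc v} _ _ v∈A
    rewrite 𝔼-const A 0 | *-zeroʳ a | 𝔼-cong A (λ B → +-identityʳ (𝟙∉ v B)) =
      cong (D *_) (𝔼-𝟙∉ A v v∈A)
  𝔼-𝟙∉-pair (inside ∷ A) {suc u} {zero} _ u∈A _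
    rewrite 𝔼-cong A (λ B → *-zeroʳ (𝟙∉ u B)) | 𝔼-const A 0 | *-zeroʳ a
          | 𝔼-cong A (λ B → *-identityʳ (𝟙∉ u B)) =
      cong (D *_) (𝔼-𝟙∉ A u u∈A)
  𝔼-𝟙∉-pair (inside ∷ A) {suc u} {suc v} u≢v u∈A v∈A =
    trans (cong (λ x → D * (D * x)) (+-comm (a * E) E))
          (cong (D *_) (𝔼-𝟙∉-pair A (u≢v ∘ cong suc) u∈A v∈A))
    where E = 𝔼 A (λ B → 𝟙∉ u B * 𝟙∉ v B)
  𝔼-𝟙∉-pair (outside ∷ A) {suc u} {suc v} u≢v u∈A v∈A = 𝔼-𝟙∉-pair A (u≢v ∘ cong suc) u∈A v∈A

  𝔼-𝟙∉-pair-≤ : ∀ {N} (A : Subset N) u v → lookup A u ≡ true → lookup A v ≡ true →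
                D * (D * 𝔼 A (λ B → 𝟙∉ u B * 𝟙∉ v B)) ≤ D ^ ∣ A ∣ + 𝟙 (does (u ≟ᶠ v)) * (a * D ^ ∣ A ∣)
  𝔼-𝟙∉-pair-≤ A u v u∈A v∈A with u ≟ᶠ v
  ... | no u≢v  = ≤-reflexive (trans (𝔼-𝟙∉-pair A u≢v u∈A v∈A) (sym (+-identityʳ _)))
  ... | yes refl rewrite 𝔼-cong A (λ B → 𝟙-idem (not (lookup B u))) | 𝔼-𝟙∉ A u u∈A
                       | +-identityʳ (a * D ^ ∣ A ∣) = ≤-refl

  markov : ∀ {N} (A : Subset N) c (f : Subset N → ℕ) → c * 𝔼 A (λ B → 𝟙 (does (c ≤? f B))) ≤ 𝔼 A f
  markov A c f = ≤-trans (≤-reflexive (sym (𝔼-* A c _))) (𝔼-mono A (λ B _ → indicator (c ≤? f B)))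
    where
    indicator : ∀ {x} (c≤?x : Dec (c ≤ x)) → c * 𝟙 (does c≤?x) ≤ x
    indicator (yes c≤x) = ≤-trans (≤-reflexive (*-identityʳ c)) c≤x
    indicator (no _)    = ≤-trans (≤-reflexive (*-zeroʳ c)) z≤n

2mn≤m²+n² : ∀ m n → 2 * (m * n) ≤ m * m + n * n
2mn≤m²+n² m n = [ ordered , swapped ]′ (≤-total m n)
  where
  ordered : ∀ {m n} → m ≤ n → 2 * (m * n) ≤ m * m + n * n
  ordered {m} {n} m≤n rewrite sym (m+[n∸m]≡n m≤n) = m+n≤o⇒m≤o _ (≤-reflexive (expand m (n ∸ m)))
    where
    expand : ∀ m t → 2 * (m * (m + t)) + t * t ≡ m * m + (m + t) * (m + t)
    expand = solve-∀
  swapped : n ≤ m → 2 * (m * n) ≤ m * m + n * n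
  swapped n≤m = subst₂ _≤_ (cong (2 *_) (*-comm n m)) (+-comm (n * n) (m * m)) (ordered n≤m)

-- Chebyshev's inequality pointwise, for Y with mean s: s²·[2Y ≤ s] ≤ 4(s - Y)².
chebyshev-pointwise : ∀ s Y (2Y≤?s : Dec (2 * Y ≤ s)) →
  s * s * 𝟙 (does 2Y≤?s) + 8 * s * Y ≤ 4 * s * s + 4 * (Y * Y)
chebyshev-pointwise s Y (yes 2Y≤s) rewrite sym (m+[n∸m]≡n 2Y≤s) =
  m+n≤o⇒m≤o _ (≤-reflexive (expand Y (s ∸ 2 * Y)))
  where
  expand : ∀ Y t → (2 * Y + t) * (2 * Y + t) * 1 + 8 * (2 * Y + t) * Y + (4 * t * Y + 3 * (t * t))
                 ≡ 4 * (2 * Y + t) * (2 * Y + t) + 4 * (Y * Y)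
  expand = solve-∀
chebyshev-pointwise s Y (no _) = begin
  s * s * 0 + 8 * s * Y   ≡⟨ regroup s Y ⟩
  4 * (2 * (s * Y))       ≤⟨ *-monoʳ-≤ 4 (2mn≤m²+n² s Y) ⟩
  4 * (s * s + Y * Y)     ≡⟨ *-distribˡ-+ 4 (s * s) (Y * Y) ⟩
  4 * (s * s) + 4 * (Y * Y) ≡⟨ cong (_+ 4 * (Y * Y)) (sym (*-assoc 4 s s)) ⟩
  4 * s * s + 4 * (Y * Y) ∎
  where
  open ≤-Reasoning
  regroup : ∀ s Y → s * s * 0 + 8 * s * Y ≡ 4 * (2 * (s * Y))
  regroup = solve-∀

-- X B counts the Q-vertices missing from B: D·X has mean s and variance a·s, so by Chebyshev the
-- event `few` (X at most half its mean) has probability at most 4a/s.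
module LowerTail (a : ℕ) {N} (A : Subset N) (Q : Fin N → Bool)
                 (Q⊆A : ∀ v → Q v ≡ true → lookup A v ≡ true) where
  open SubsetSum a

  s : ℕ
  s = sum (𝟙 ∘ Q)

  X : Subset N → ℕ
  X B = sum (λ v → 𝟙 (Q v) * 𝟙∉ v B)

  T : ℕ
  T = D ^ ∣ A ∣

  mean : D * 𝔼 A X ≡ s * T
  mean = begin
    D * 𝔼 A X                                   ≡⟨ cong (D *_) (𝔼-sum A (λ v B → 𝟙 (Q v) * 𝟙∉ v B)) ⟩
    D * sum (λ v → 𝔼 A (λ B → 𝟙 (Q v) * 𝟙∉ v B)) ≡⟨ *-distribˡ-sum D (λ v → 𝔼 A (λ B → 𝟙 (Q v) * 𝟙∉ v B)) ⟩
    sum (λ v → D * 𝔼 A (λ B → 𝟙 (Q v) * 𝟙∉ v B)) ≡⟨ sum-cong-≗ term ⟩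
    sum (λ v → 𝟙 (Q v) * T)                     ≡⟨ sum-*ʳ (𝟙 ∘ Q) T ⟩
    s * T                                       ∎
    where
    open ≡-Reasoning
    term : ∀ v → D * 𝔼 A (λ B → 𝟙 (Q v) * 𝟙∉ v B) ≡ 𝟙 (Q v) * T
    term v with Q v | Q⊆A v
    ... | false | _   = trans (cong (D *_) (𝔼-const A 0)) (*-zeroʳ D)
    ... | true  | v∈A = trans (cong (D *_) (𝔼-cong A (λ B → +-identityʳ (𝟙∉ v B))))
                              (trans (𝔼-𝟙∉ A v (v∈A refl)) (sym (+-identityʳ T)))

  sum²≡∑∑ : ∀ (f : Fin N → ℕ) → sum f * sum f ≡ sum (λ u → sum (λ v → f u * f v))
  sum²≡∑∑ f = begin
    sum f * sum f                        ≡⟨ *-distribʳ-sum (sum f) f ⟩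
    sum (λ u → f u * sum f)              ≡⟨ sum-cong-≗ (λ u → *-distribˡ-sum (f u) f) ⟩
    sum (λ u → sum (λ v → f u * f v))    ∎
    where open ≡-Reasoning

  pair : Fin N → Fin N → Subset N → ℕ
  pair u v B = 𝟙∉ u B * 𝟙∉ v B

  𝔼-X² : 𝔼 A (λ B → X B * X B) ≡ sum (λ u → sum (λ v → 𝟙 (Q u) * 𝟙 (Q v) * 𝔼 A (pair u v)))
  𝔼-X² = begin
    𝔼 A (λ B → X B * X B)
      ≡⟨ 𝔼-cong A (λ B → trans (sum²≡∑∑ (λ v → 𝟙 (Q v) * 𝟙∉ v B)) (sum-cong-≗ (λ u → sum-cong-≗ (λ v →
           [m*n]*[o*p]≡[m*o]*[n*p] (𝟙 (Q u)) (𝟙∉ u B) (𝟙 (Q v)) (𝟙∉ v B))))) ⟩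
    𝔼 A (λ B → sum (λ u → sum (λ v → 𝟙 (Q u) * 𝟙 (Q v) * pair u v B)))
      ≡⟨ 𝔼-sum A (λ u B → sum (λ v → 𝟙 (Q u) * 𝟙 (Q v) * pair u v B)) ⟩
    sum (λ u → 𝔼 A (λ B → sum (λ v → 𝟙 (Q u) * 𝟙 (Q v) * pair u v B)))
      ≡⟨ sum-cong-≗ (λ u → trans (𝔼-sum A (λ v B → 𝟙 (Q u) * 𝟙 (Q v) * pair u v B))
                                 (sum-cong-≗ (λ v → 𝔼-* A (𝟙 (Q u) * 𝟙 (Q v)) (pair u v)))) ⟩
    sum (λ u → sum (λ v → 𝟙 (Q u) * 𝟙 (Q v) * 𝔼 A (pair u v))) ∎
    where open ≡-Reasoning

  pair-bound : ∀ u v → D * D * (𝟙 (Q u) * 𝟙 (Q v) * 𝔼 A (pair u v))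
                       ≤ 𝟙 (Q u) * (𝟙 (Q v) * T + 𝟙 (does (u ≟ᶠ v)) * (a * T))
  pair-bound u v with Q u | Q⊆A u | Q v | Q⊆A v
  ... | false | _   | _     | _   = ≤-reflexive (*-zeroʳ (D * D))
  ... | true  | _   | false | _   = ≤-trans (≤-reflexive (*-zeroʳ (D * D))) z≤n
  ... | true  | u∈A | true  | v∈A = begin
    D * D * (1 * 1 * E)       ≡⟨ cong (D * D *_) (*-identityˡ E) ⟩
    D * D * E                 ≡⟨ *-assoc D D E ⟩
    D * (D * E)               ≤⟨ 𝔼-𝟙∉-pair-≤ A u v (u∈A refl) (v∈A refl) ⟩
    T + 𝟙 (does (u ≟ᶠ v)) * (a * T)           ≡⟨ sym (cong (_+ 𝟙 (does (u ≟ᶠ v)) * (a * T)) (*-identityˡ T)) ⟩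
    1 * T + 𝟙 (does (u ≟ᶠ v)) * (a * T)       ≡⟨ sym (*-identityˡ _) ⟩
    1 * (1 * T + 𝟙 (does (u ≟ᶠ v)) * (a * T)) ∎
    where
    open ≤-Reasoning
    E = 𝔼 A (pair u v)

  row-sum : ∀ u → sum (λ v → 𝟙 (Q u) * (𝟙 (Q v) * T + 𝟙 (does (u ≟ᶠ v)) * (a * T))) ≡ 𝟙 (Q u) * (s * T + a * T)
  row-sum u = begin
    sum (λ v → 𝟙 (Q u) * (𝟙 (Q v) * T + 𝟙 (does (u ≟ᶠ v)) * (a * T)))
      ≡⟨ *-distribˡ-sum (𝟙 (Q u)) (λ v → 𝟙 (Q v) * T + 𝟙 (does (u ≟ᶠ v)) * (a * T)) ⟨
    𝟙 (Q u) * sum (λ v → 𝟙 (Q v) * T + 𝟙 (does (u ≟ᶠ v)) * (a * T))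
      ≡⟨ cong (𝟙 (Q u) *_) (∑-distrib-+ (λ v → 𝟙 (Q v) * T) (λ v → 𝟙 (does (u ≟ᶠ v)) * (a * T))) ⟩
    𝟙 (Q u) * (sum (λ v → 𝟙 (Q v) * T) + sum (λ v → 𝟙 (does (u ≟ᶠ v)) * (a * T)))
      ≡⟨ cong (𝟙 (Q u) *_) (cong₂ _+_ (sum-*ʳ (𝟙 ∘ Q) T)
           (trans (sum-*ʳ (λ v → 𝟙 (does (u ≟ᶠ v))) (a * T)) (trans (cong (_* (a * T)) (sum-≟ u)) (*-identityˡ (a * T))))) ⟩
    𝟙 (Q u) * (s * T + a * T) ∎
    where open ≡-Reasoning

  second-moment : D * D * 𝔼 A (λ B → X B * X B) ≤ s * (s * T + a * T)
  second-moment = begin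
    D * D * 𝔼 A (λ B → X B * X B)
      ≡⟨ cong (D * D *_) 𝔼-X² ⟩
    D * D * sum (λ u → sum (λ v → 𝟙 (Q u) * 𝟙 (Q v) * 𝔼 A (pair u v)))
      ≡⟨ trans (*-distribˡ-sum (D * D) (λ u → sum (λ v → 𝟙 (Q u) * 𝟙 (Q v) * 𝔼 A (pair u v))))
               (sum-cong-≗ (λ u → *-distribˡ-sum (D * D) (λ v → 𝟙 (Q u) * 𝟙 (Q v) * 𝔼 A (pair u v)))) ⟩
    sum (λ u → sum (λ v → D * D * (𝟙 (Q u) * 𝟙 (Q v) * 𝔼 A (pair u v))))
      ≤⟨ sum-mono (λ u → sum-mono (pair-bound u)) ⟩
    sum (λ u → sum (λ v → 𝟙 (Q u) * (𝟙 (Q v) * T + 𝟙 (does (u ≟ᶠ v)) * (a * T))))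
      ≡⟨ sum-cong-≗ row-sum ⟩
    sum (λ u → 𝟙 (Q u) * (s * T + a * T))
      ≡⟨ sum-*ʳ (𝟙 ∘ Q) (s * T + a * T) ⟩
    s * (s * T + a * T) ∎
    where open ≤-Reasoning

  few : Subset N → ℕ
  few B = 𝟙 (does (2 * (D * X B) ≤? s))

  chebyshev : s * s * 𝔼 A few + 8 * s * (s * T) ≤ 4 * s * s * T + 4 * (s * (s * T + a * T))
  chebyshev = begin
    s * s * 𝔼 A few + 8 * s * (s * T)
      ≡⟨ cong₂ _+_ (sym (𝔼-* A (s * s) few)) (cong (8 * s *_) (sym mean)) ⟩
    𝔼 A (λ B → s * s * few B) + 8 * s * (D * 𝔼 A X)
      ≡⟨ cong (_+_ (𝔼 A (λ B → s * s * few B))) (trans (cong (8 * s *_) (sym (𝔼-* A D X))) (sym (𝔼-* A (8 * s) (λ B → D * X B)))) ⟩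
    𝔼 A (λ B → s * s * few B) + 𝔼 A (λ B → 8 * s * (D * X B))
      ≡⟨ 𝔼-+ A (λ B → s * s * few B) (λ B → 8 * s * (D * X B)) ⟨
    𝔼 A (λ B → s * s * few B + 8 * s * (D * X B))
      ≤⟨ 𝔼-mono A (λ B _ → chebyshev-pointwise s (D * X B) (2 * (D * X B) ≤? s)) ⟩
    𝔼 A (λ B → 4 * s * s + 4 * (D * X B * (D * X B)))
      ≡⟨ 𝔼-+ A (λ _ → 4 * s * s) (λ B → 4 * (D * X B * (D * X B))) ⟩
    𝔼 A (λ _ → 4 * s * s) + 𝔼 A (λ B → 4 * (D * X B * (D * X B)))
      ≡⟨ cong₂ _+_ (𝔼-const A (4 * s * s)) (trans (𝔼-cong A (λ B → square D (X B)))
                                                 (trans (𝔼-* A 4 _) (cong (4 *_) (𝔼-* A (D * D) _)))) ⟩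
    4 * s * s * T + 4 * (D * D * 𝔼 A (λ B → X B * X B))
      ≤⟨ +-monoʳ-≤ (4 * s * s * T) (*-monoʳ-≤ 4 second-moment) ⟩
    4 * s * s * T + 4 * (s * (s * T + a * T)) ∎
    where
    open ≤-Reasoning
    square : ∀ d x → 4 * (d * x * (d * x)) ≡ 4 * (d * d * (x * x))
    square = solve-∀

  lower-tail : s * 𝔼 A few ≤ 4 * a * T
  lower-tail with s ≟ 0
  ... | yes s≡0 rewrite s≡0 = z≤n
  ... | no s≢0 = *-cancelˡ-≤ s {{≢-nonZero s≢0}} (+-cancelʳ-≤ (8 * s * (s * T)) _ _
    (subst₂ _≤_ (cong (_+ 8 * s * (s * T)) (*-assoc s s (𝔼 A few))) (regroup s T a) chebyshev))
    where
    regroup : ∀ s t a → 4 * s * s * t + 4 * (s * (s * t + a * t)) ≡ s * (4 * a * t) + 8 * s * (s * t)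
    regroup = solve-∀

module Defect (G : Hypergraph) (A : Subset (n G)) where

  chosenEdge : ∀ {v} → Dec (NonIsolated G A v) → Subset (n G)
  chosenEdge (yes (_ , v∈e⊆A)) = proj₁ (find v∈e⊆A)
  chosenEdge (no _)            = ∅

  defectAt : ∀ {v} → Dec (NonIsolated G A v) → Subset (n G) → ℕ
  defectAt {v} d B = 𝟙 (does d) * (𝟙∉ v B * sum (λ u → 𝟙 (lookup (chosenEdge d) u ∧ not (does (u ≟ᶠ v))) * 𝟙∉ u B))

  defect : Subset (n G) → ℕ
  defect B = sum (λ v → defectAt (nonIsolated? G A v) B)

  connected⇒nonIsolated : ∀ {B v} → B ⊆ A → v ∈ A → Connected G B v → NonIsolated G A v
  connected⇒nonIsolated {B} {v} B⊆A v∈A (_ , conn) = v∈A , Any.map edge⊆A conn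
    where
    edge⊆A : ∀ {e} → v ∈ e × (e - v) ⊆ B → e ⊆ A × v ∈ e
    edge⊆A {e} (v∈e , e-v⊆B) = (λ {x} x∈e → member x∈e) , v∈e
      where
      member : ∀ {x} → x ∈ e → x ∈ A
      member {x} x∈e with x ≟ᶠ v
      ... | yes refl = v∈A
      ... | no x≢v   = B⊆A (e-v⊆B (x∈p∧x≢y⇒x∈p-y x∈e x≢v))

  others-in-B⇒connected : ∀ {B v} → v ∉ B → (v∈e⊆A : Any (λ e → e ⊆ A × v ∈ e) (edges G)) →
    let e = proj₁ (find v∈e⊆A) in
    sum (λ u → 𝟙 (lookup e u ∧ not (does (u ≟ᶠ v))) * 𝟙∉ u B) ≡ 0 → Connected G B v
  others-in-B⇒connected {B} {v} v∉B v∈e⊆A none with find v∈e⊆A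
  ... | e , e∈E , (e⊆A , v∈e) = v∉B , lose e∈E (v∈e , e-v⊆B)
    where
    e-v⊆B : (e - v) ⊆ B
    e-v⊆B {x} x∈e-v with x ≟ᶠ v | sum≡0⇒≡0 (λ u → 𝟙 (lookup e u ∧ not (does (u ≟ᶠ v))) * 𝟙∉ u B) none x
    ... | yes x≡v | _ = contradiction x≡v (x∉⁅y⁆⇒x≢y (x∈p─q⇒x∉q e ⁅ v ⁆ x∈e-v))
    ... | no _    | term≡0 rewrite []=⇒lookup (p─q⊆p e ⁅ v ⁆ x∈e-v) =
      𝟙∉≡0⇒∈ x B (trans (sym (+-identityʳ (𝟙∉ x B))) term≡0)

  mAB-term≤h-term+defectAt : ∀ {v} B (v∈?A : Dec (v ∈ A)) (v∈?B : Dec (v ∈ B))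
    (ni? : Dec (NonIsolated G A v)) (conn? : Dec (Connected G B v)) →
    𝟙 (does ((v∈?A ×-dec ¬? v∈?B) ×-dec ni?)) ≤ 𝟙 (does ((v∈?A ×-dec ¬? v∈?B) ×-dec conn?)) + defectAt ni? B
  mAB-term≤h-term+defectAt B (no _)  _       _       _        = z≤n
  mAB-term≤h-term+defectAt B (yes _) (yes _) _       _        = z≤n
  mAB-term≤h-term+defectAt B (yes _) (no _)  (no _)  _        = z≤n
  mAB-term≤h-term+defectAt B (yes _) (no _)  (yes _) (yes _)  = s≤s z≤n
  mAB-term≤h-term+defectAt {v} B (yes _) (no v∉B) (yes (_ , v∈e⊆A)) (no ¬conn)
    rewrite x∉p⇒lookup≡false v∉B
    with sum (λ u → 𝟙 (lookup (proj₁ (find v∈e⊆A)) u ∧ not (does (u ≟ᶠ v))) * 𝟙∉ u B) in others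
  ... | suc _ = s≤s z≤n
  ... | zero  = contradiction (others-in-B⇒connected v∉B v∈e⊆A others) ¬conn

  h-term≤mAB-term : ∀ {v B} → B ⊆ A → (v∈?A : Dec (v ∈ A)) (v∈?B : Dec (v ∈ B))
    (ni? : Dec (NonIsolated G A v)) (conn? : Dec (Connected G B v)) →
    𝟙 (does ((v∈?A ×-dec ¬? v∈?B) ×-dec conn?)) ≤ 𝟙 (does ((v∈?A ×-dec ¬? v∈?B) ×-dec ni?))
  h-term≤mAB-term B⊆A (no _)    _       _       _          = z≤n
  h-term≤mAB-term B⊆A (yes _)   (yes _) _       _          = z≤n
  h-term≤mAB-term B⊆A (yes _)   (no _)  _       (no _)     = z≤n
  h-term≤mAB-term B⊆A (yes _)   (no _)  (yes _) (yes _)    = ≤-refl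
  h-term≤mAB-term B⊆A (yes v∈A) (no _)  (no ¬ni) (yes conn) =
    contradiction (connected⇒nonIsolated B⊆A v∈A conn) ¬ni

count≡sum : ∀ G {P : Fin (n G) → Set} (P? : ∀ v → Dec (P v)) → count G P? ≡ sum (λ v → 𝟙 (does (P? v)))
count≡sum G P? = length-filter-tabulate P? (λ v → v)

module _ (G : Hypergraph) (A : Subset (n G)) where
  open Defect G A

  mAB≤h+defect : ∀ B → mAB G A B ≤ h G A B + defect B
  mAB≤h+defect B = begin
    mAB G A B
      ≡⟨ count≡sum G _ ⟩
    sum (λ v → 𝟙 (does (((v ∈? A) ×-dec ¬? (v ∈? B)) ×-dec nonIsolated? G A v)))
      ≤⟨ sum-mono (λ v → mAB-term≤h-term+defectAt B (v ∈? A) (v ∈? B) (nonIsolated? G A v) (connected? G B v)) ⟩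
    sum (λ v → 𝟙 (does (((v ∈? A) ×-dec ¬? (v ∈? B)) ×-dec connected? G B v)) + defectAt (nonIsolated? G A v) B)
      ≡⟨ ∑-distrib-+ (λ v → 𝟙 (does (((v ∈? A) ×-dec ¬? (v ∈? B)) ×-dec connected? G B v)))
                     (λ v → defectAt (nonIsolated? G A v) B) ⟩
    sum (λ v → 𝟙 (does (((v ∈? A) ×-dec ¬? (v ∈? B)) ×-dec connected? G B v))) + defect B
      ≡⟨ cong (_+ defect B) (count≡sum G _) ⟨
    h G A B + defect B ∎
    where open ≤-Reasoning

  h≤mAB : ∀ {B} → B ⊆ A → h G A B ≤ mAB G A B
  h≤mAB {B} B⊆A = begin
    h G A B
      ≡⟨ count≡sum G _ ⟩
    sum (λ v → 𝟙 (does (((v ∈? A) ×-dec ¬? (v ∈? B)) ×-dec connected? G B v)))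
      ≤⟨ sum-mono (λ v → h-term≤mAB-term B⊆A (v ∈? A) (v ∈? B) (nonIsolated? G A v) (connected? G B v)) ⟩
    sum (λ v → 𝟙 (does (((v ∈? A) ×-dec ¬? (v ∈? B)) ×-dec nonIsolated? G A v)))
      ≡⟨ count≡sum G _ ⟨
    mAB G A B ∎
    where open ≤-Reasoning

  nonIsolated⇒∈ : ∀ v → does (nonIsolated? G A v) ≡ true → lookup A v ≡ true
  nonIsolated⇒∈ v = []=⇒lookup ∘ proj₁ ∘ does≡true⇒ (nonIsolated? G A v)

  m≡sum : m G A ≡ sum (λ v → 𝟙 (does (nonIsolated? G A v)))
  m≡sum = count≡sum G (nonIsolated? G A)

  mAB≡sum : ∀ B → mAB G A B ≡ sum (λ v → 𝟙 (does (nonIsolated? G A v)) * 𝟙∉ v B)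
  mAB≡sum B = trans (count≡sum G _) (sum-cong-≗ (λ v → indicator (v ∈? A) (v ∈? B) (nonIsolated? G A v)))
    where
    indicator : ∀ {v} (v∈?A : Dec (v ∈ A)) (v∈?B : Dec (v ∈ B)) (ni? : Dec (NonIsolated G A v)) →
                𝟙 (does ((v∈?A ×-dec ¬? v∈?B) ×-dec ni?)) ≡ 𝟙 (does ni?) * 𝟙∉ v B
    indicator (no _)   _         (no _)          = refl
    indicator (no v∉A) _         (yes (v∈A , _)) = contradiction v∈A v∉A
    indicator (yes _)  (yes v∈B) ni?             rewrite []=⇒lookup v∈B = sym (*-zeroʳ (𝟙 (does ni?)))
    indicator (yes _)  (no v∉B)  ni?             rewrite x∉p⇒lookup≡false v∉B = sym (*-identityʳ (𝟙 (does ni?)))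

  mAB≤m : ∀ B → mAB G A B ≤ m G A
  mAB≤m B = begin
    mAB G A B                                                 ≡⟨ mAB≡sum B ⟩
    sum (λ v → 𝟙 (does (nonIsolated? G A v)) * 𝟙∉ v B)       ≤⟨ sum-mono (λ v → 𝟙*𝟙≤𝟙 (does (nonIsolated? G A v)) (not (lookup B v))) ⟩
    sum (λ v → 𝟙 (does (nonIsolated? G A v)))                ≡⟨ m≡sum ⟨
    m G A                                                     ∎
    where open ≤-Reasoning

module _ (a : ℕ) (G : Hypergraph) (A : Subset (n G)) where
  open SubsetSum a
  open Defect G A

  private
    T : ℕ
    T = D ^ ∣ A ∣

  𝔼-defectAt : ∀ {r v} → All (λ e → ∣ e ∣ ≤ r) (edges G) → (ni? : Dec (NonIsolated G A v)) →
               D * D * 𝔼 A (defectAt ni?) ≤ 𝟙 (does ni?) * (r * T)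
  𝔼-defectAt {r} {v} _ (no _) = ≤-reflexive (trans (cong (D * D *_) (𝔼-const A 0)) (*-zeroʳ (D * D)))
  𝔼-defectAt {r} {v} rank (yes (v∈A , v∈e⊆A)) with find v∈e⊆A
  ... | e , e∈E , (e⊆A , v∈e) = begin
    D * D * 𝔼 A (λ B → 1 * (𝟙∉ v B * sum (λ u → 𝟙 (other u) * 𝟙∉ u B)))
      ≡⟨ cong (D * D *_) (trans (𝔼-cong A expand) (𝔼-sum A (λ u B → 𝟙 (other u) * pair u B))) ⟩
    D * D * sum (λ u → 𝔼 A (λ B → 𝟙 (other u) * pair u B))
      ≡⟨ *-distribˡ-sum (D * D) (λ u → 𝔼 A (λ B → 𝟙 (other u) * pair u B)) ⟩
    sum (λ u → D * D * 𝔼 A (λ B → 𝟙 (other u) * pair u B))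
      ≡⟨ sum-cong-≗ (λ u → trans (cong (D * D *_) (𝔼-* A (𝟙 (other u)) (pair u))) (reorder D (𝟙 (other u)) _)) ⟩
    sum (λ u → 𝟙 (other u) * (D * (D * 𝔼 A (pair u))))
      ≤⟨ sum-mono per-vertex ⟩
    sum (λ u → 𝟙 (lookup e u) * T)
      ≡⟨ trans (sum-*ʳ (λ u → 𝟙 (lookup e u)) T) (cong (_* T) (sym (∣p∣≡sum e))) ⟩
    ∣ e ∣ * T
      ≤⟨ *-monoˡ-≤ T (All.lookup rank e∈E) ⟩
    r * T
      ≡⟨ *-identityˡ (r * T) ⟨
    1 * (r * T) ∎
    where
    open ≤-Reasoning
    other : Fin (n G) → Bool
    other u = lookup e u ∧ not (does (u ≟ᶠ v))
    pair : Fin (n G) → Subset (n G) → ℕ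
    pair u B = 𝟙∉ v B * 𝟙∉ u B
    expand : ∀ B → 1 * (𝟙∉ v B * sum (λ u → 𝟙 (other u) * 𝟙∉ u B)) ≡ sum (λ u → 𝟙 (other u) * pair u B)
    expand B = trans (*-identityˡ _) (trans (*-distribˡ-sum (𝟙∉ v B) (λ u → 𝟙 (other u) * 𝟙∉ u B))
                 (sum-cong-≗ (λ u → x∙yz≈y∙xz (𝟙∉ v B) (𝟙 (other u)) (𝟙∉ u B))))
    reorder : ∀ d c x → d * d * (c * x) ≡ c * (d * (d * x))
    reorder = solve-∀
    per-vertex : ∀ u → 𝟙 (other u) * (D * (D * 𝔼 A (pair u))) ≤ 𝟙 (lookup e u) * T
    per-vertex u with lookup e u in u∈e | u ≟ᶠ v
    ... | false | _       = z≤n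
    ... | true  | yes _   = z≤n
    ... | true  | no u≢v  = ≤-reflexive (trans (*-identityˡ _) (trans
          (𝔼-𝟙∉-pair A (u≢v ∘ sym) ([]=⇒lookup v∈A) ([]=⇒lookup (e⊆A (lookup⇒[]= u e u∈e))))
          (sym (*-identityˡ T))))

  𝔼-defect : ∀ {r} → All (λ e → ∣ e ∣ ≤ r) (edges G) → D * D * 𝔼 A defect ≤ m G A * (r * T)
  𝔼-defect {r} rank = begin
    D * D * 𝔼 A defect
      ≡⟨ cong (D * D *_) (𝔼-sum A (λ v → defectAt (nonIsolated? G A v))) ⟩
    D * D * sum (λ v → 𝔼 A (defectAt (nonIsolated? G A v)))
      ≡⟨ *-distribˡ-sum (D * D) (λ v → 𝔼 A (defectAt (nonIsolated? G A v))) ⟩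
    sum (λ v → D * D * 𝔼 A (defectAt (nonIsolated? G A v)))
      ≤⟨ sum-mono (λ v → 𝔼-defectAt rank (nonIsolated? G A v)) ⟩
    sum (λ v → 𝟙 (does (nonIsolated? G A v)) * (r * T))
      ≡⟨ trans (sum-*ʳ (λ v → 𝟙 (does (nonIsolated? G A v))) (r * T)) (cong (_* (r * T)) (sym (m≡sum G A))) ⟩
    m G A * (r * T) ∎
    where open ≤-Reasoning

ι : ℕ → ℚ
ι n = + n / 1

private
  ι′ : ℕ → ℚ
  ι′ n = mkℚ (+ n) 0 (Coprime.sym (1-coprimeTo n))

  ι≡ι′ : ∀ n → ι n ≡ ι′ n
  ι≡ι′ n = ℚ.normalize-coprime (Coprime.sym (1-coprimeTo n))

ι-+ : ∀ m n → ι (m ℕ.+ n) ≡ ι m ℚ.+ ι n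
ι-+ m n rewrite ι≡ι′ (m ℕ.+ n) | ι≡ι′ m | ι≡ι′ n =
  ℚ.toℚᵘ-injective (ℚᵘ.≃-trans numerators (ℚᵘ.≃-sym (ℚ.toℚᵘ-homo-+ (ι′ m) (ι′ n))))
  where
  unit-denominators : ∀ x y → (x ℤ.+ y) ℤ.* (+ 1 ℤ.* + 1) ≡ (x ℤ.* + 1 ℤ.+ y ℤ.* + 1) ℤ.* + 1
  unit-denominators = ℤ.solve-∀
  numerators : toℚᵘ (ι′ (m ℕ.+ n)) ℚᵘ.≃ toℚᵘ (ι′ m) ℚᵘ.+ toℚᵘ (ι′ n)
  numerators = ℚᵘ.*≡* (trans (cong (ℤ._* (+ 1 ℤ.* + 1)) (ℤ.pos-+ m n)) (unit-denominators (+ m) (+ n)))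

ι-* : ∀ m n → ι (m ℕ.* n) ≡ ι m ℚ.* ι n
ι-* m n rewrite ι≡ι′ (m ℕ.* n) | ι≡ι′ m | ι≡ι′ n =
  ℚ.toℚᵘ-injective (ℚᵘ.≃-trans numerators (ℚᵘ.≃-sym (ℚ.toℚᵘ-homo-* (ι′ m) (ι′ n))))
  where
  unit-denominators : ∀ x y → (x ℤ.* y) ℤ.* (+ 1 ℤ.* + 1) ≡ (x ℤ.* y) ℤ.* + 1
  unit-denominators = ℤ.solve-∀
  numerators : toℚᵘ (ι′ (m ℕ.* n)) ℚᵘ.≃ toℚᵘ (ι′ m) ℚᵘ.* toℚᵘ (ι′ n)
  numerators = ℚᵘ.*≡* (trans (cong (ℤ._* (+ 1 ℤ.* + 1)) (ℤ.pos-* m n)) (unit-denominators (+ m) (+ n)))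

ι-mono-≤ : ∀ {m n} → m ℕ.≤ n → ι m ℚ.≤ ι n
ι-mono-≤ {m} {n} m≤n rewrite ι≡ι′ m | ι≡ι′ n = ℚ.*≤* (ℤ.*-monoʳ-≤-nonNeg (+ 1) (ℤ.+≤+ m≤n))

ι-cancel-≤ : ∀ {m n} → ι m ℚ.≤ ι n → m ℕ.≤ n
ι-cancel-≤ {m} {n} ιm≤ιn rewrite ι≡ι′ m | ι≡ι′ n with ιm≤ιn
... | ℚ.*≤* m*1≤n*1 = ℤ.drop‿+≤+ (subst₂ ℤ._≤_ (ℤ.*-identityʳ (+ m)) (ℤ.*-identityʳ (+ n)) m*1≤n*1)

1/n*n≡1 : ∀ n → (+ 1 / suc n) ℚ.* ι (suc n) ≡ 1ℚ
1/n*n≡1 n rewrite ι≡ι′ (suc n) | ℚ.normalize-coprime {1} {n} (1-coprimeTo (suc n)) = ℚ.*-inverseˡ (ι′ (suc n))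

sumℚ-++ : (xs ys : List ℚ) → sumℚ (xs ++ ys) ≡ sumℚ xs ℚ.+ sumℚ ys
sumℚ-++ []       ys = sym (ℚ.+-identityˡ (sumℚ ys))
sumℚ-++ (x ∷ xs) ys = trans (cong (x ℚ.+_) (sumℚ-++ xs ys)) (sym (ℚ.+-assoc x (sumℚ xs) (sumℚ ys)))

sumℚ-map-cong : ∀ {X : Set} {f g : X → ℚ} (xs : List X) → (∀ x → f x ≡ g x) → sumℚ (map f xs) ≡ sumℚ (map g xs)
sumℚ-map-cong []       f≡g = refl
sumℚ-map-cong (x ∷ xs) f≡g = cong₂ ℚ._+_ (f≡g x) (sumℚ-map-cong xs f≡g)

sumℚ-map-* : ∀ {X : Set} c (f : X → ℚ) (xs : List X) → sumℚ (map (λ x → c ℚ.* f x) xs) ≡ c ℚ.* sumℚ (map f xs)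
sumℚ-map-* c f []       = sym (ℚ.*-zeroʳ c)
sumℚ-map-* c f (x ∷ xs) = trans (cong (c ℚ.* f x ℚ.+_) (sumℚ-map-* c f xs)) (sym (ℚ.*-distribˡ-+ c (f x) _))

sumℚ-map-0 : ∀ {X : Set} (xs : List X) → sumℚ (map (λ _ → 0ℚ) xs) ≡ 0ℚ
sumℚ-map-0 []       = refl
sumℚ-map-0 (x ∷ xs) = trans (ℚ.+-identityˡ _) (sumℚ-map-0 xs)

sumℚ-filter : ∀ {X : Set} {P : X → Set} (P? : ∀ x → Dec (P x)) (w : X → ℚ) (xs : List X) →
  sumℚ (map w (filter P? xs)) ≡ sumℚ (map (λ x → if does (P? x) then w x else 0ℚ) xs)
sumℚ-filter P? w []       = refl
sumℚ-filter P? w (x ∷ xs) with does (P? x)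
... | true  = cong (w x ℚ.+_) (sumℚ-filter P? w xs)
... | false = trans (sumℚ-filter P? w xs) (sym (ℚ.+-identityˡ _))

sumℚ-allSubsets : ∀ {N} (f : Subset (suc N) → ℚ) →
  sumℚ (map f (allSubsets (suc N)))
    ≡ sumℚ (map (f ∘ (inside ∷_)) (allSubsets N)) ℚ.+ sumℚ (map (f ∘ (outside ∷_)) (allSubsets N))
sumℚ-allSubsets {N} f = begin
  sumℚ (map f (map (inside ∷_) S ++ map (outside ∷_) S))
    ≡⟨ cong sumℚ (map-++ f (map (inside ∷_) S) (map (outside ∷_) S)) ⟩
  sumℚ (map f (map (inside ∷_) S) ++ map f (map (outside ∷_) S))
    ≡⟨ sumℚ-++ (map f (map (inside ∷_) S)) (map f (map (outside ∷_) S)) ⟩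
  sumℚ (map f (map (inside ∷_) S)) ℚ.+ sumℚ (map f (map (outside ∷_) S))
    ≡⟨ cong₂ (λ xs ys → sumℚ xs ℚ.+ sumℚ ys) (map-∘ S) (map-∘ S) ⟨
  sumℚ (map (f ∘ (inside ∷_)) S) ℚ.+ sumℚ (map (f ∘ (outside ∷_)) S) ∎
  where
  open ≡-Reasoning
  S = allSubsets N

module Expectation (p : ℚ) where

  q : ℚ
  q = 1ℚ ℚ.- p

  𝔼ℚ : ∀ {N} → Subset N → (Subset N → ℚ) → ℚ
  𝔼ℚ []            g = g []
  𝔼ℚ (inside ∷ A)  g = p ℚ.* 𝔼ℚ A (g ∘ (inside ∷_)) ℚ.+ q ℚ.* 𝔼ℚ A (g ∘ (outside ∷_))
  𝔼ℚ (outside ∷ A) g = 𝔼ℚ A (g ∘ (outside ∷_))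

  private
    term : ∀ {N} → Subset N → (Subset N → ℚ) → Subset N → ℚ
    term A g B = if does (B ⊆? A) then g B ℚ.* ((p ^ℚ ∣ B ∣) ℚ.* (q ^ℚ ∣ A ─ B ∣)) else 0ℚ

    term-inside : ∀ {N} (A : Subset N) g B →
      term (inside ∷ A) g (inside ∷ B) ≡ p ℚ.* term A (g ∘ (inside ∷_)) B
    term-inside A g B with does (B ⊆? A)
    ... | true  = reorder p (g (inside ∷ B)) (p ^ℚ ∣ B ∣) (q ^ℚ ∣ A ─ B ∣)
      where
      reorder : ∀ p g P R → g ℚ.* ((p ℚ.* P) ℚ.* R) ≡ p ℚ.* (g ℚ.* (P ℚ.* R))
      reorder = solve 4 (λ p g P R → g :* ((p :* P) :* R) := p :* (g :* (P :* R))) refl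
        where open +-*-Solver
    ... | false = sym (ℚ.*-zeroʳ p)

    term-outside : ∀ {N} (A : Subset N) g B →
      term (inside ∷ A) g (outside ∷ B) ≡ q ℚ.* term A (g ∘ (outside ∷_)) B
    term-outside A g B with does (B ⊆? A)
    ... | true  = reorder q (g (outside ∷ B)) (p ^ℚ ∣ B ∣) (q ^ℚ ∣ A ─ B ∣)
      where
      reorder : ∀ q g P R → g ℚ.* (P ℚ.* (q ℚ.* R)) ≡ q ℚ.* (g ℚ.* (P ℚ.* R))
      reorder = solve 4 (λ q g P R → g :* (P :* (q :* R)) := q :* (g :* (P :* R))) refl
        where open +-*-Solver
    ... | false = sym (ℚ.*-zeroʳ q)

    sum-term≡𝔼ℚ : ∀ {N} (A : Subset N) g → sumℚ (map (term A g) (allSubsets N)) ≡ 𝔼ℚ A g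
    sum-term≡𝔼ℚ []            g = trans (ℚ.+-identityʳ _) (ℚ.*-identityʳ (g []))
    sum-term≡𝔼ℚ {suc N} (inside ∷ A)  g = trans (sumℚ-allSubsets (term (inside ∷ A) g)) (cong₂ ℚ._+_
      (trans (sumℚ-map-cong S (term-inside A g)) (trans (sumℚ-map-* p _ S) (cong (p ℚ.*_) (sum-term≡𝔼ℚ A _))))
      (trans (sumℚ-map-cong S (term-outside A g)) (trans (sumℚ-map-* q _ S) (cong (q ℚ.*_) (sum-term≡𝔼ℚ A _)))))
      where S = allSubsets N
    sum-term≡𝔼ℚ {suc N} (outside ∷ A) g = trans (sumℚ-allSubsets (term (outside ∷ A) g))
      (trans (cong₂ ℚ._+_ (sumℚ-map-0 (allSubsets N)) (sum-term≡𝔼ℚ A _)) (ℚ.+-identityˡ _))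

  prob≡𝔼ℚ : ∀ {N} (A : Subset N) {P : Subset N → Set} (P? : ∀ B → Dec (P B)) →
            prob p A P? ≡ 𝔼ℚ A (λ B → ι (𝟙 (does (P? B))))
  prob≡𝔼ℚ {N} A P? = trans (sumℚ-filter _ _ (allSubsets N)) (trans (sumℚ-map-cong (allSubsets N) indicator) (sum-term≡𝔼ℚ A _))
    where
    indicator : ∀ B → (if does ((B ⊆? A) ×-dec P? B) then (p ^ℚ ∣ B ∣) ℚ.* (q ^ℚ ∣ A ─ B ∣) else 0ℚ)
                      ≡ term A (λ B → ι (𝟙 (does (P? B)))) B
    indicator B with does (B ⊆? A) | does (P? B)
    ... | true  | true  = sym (ℚ.*-identityˡ ((p ^ℚ ∣ B ∣) ℚ.* (q ^ℚ ∣ A ─ B ∣)))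
    ... | true  | false = sym (ℚ.*-zeroˡ ((p ^ℚ ∣ B ∣) ℚ.* (q ^ℚ ∣ A ─ B ∣)))
    ... | false | _     = refl

module BinomialExpectation (a : ℕ) where
  open SubsetSum a

  p : ℚ
  p = 1ℚ ℚ.- (+ 1 / D)

  open Expectation p public

  private
    u = + 1 / D

    p*D≡a : p ℚ.* ι D ≡ ι a
    p*D≡a = begin
      (1ℚ ℚ.- u) ℚ.* ι D       ≡⟨ distrib u (ι D) ⟩
      ι D ℚ.- u ℚ.* ι D        ≡⟨ cong (λ x → ι D ℚ.- x) (1/n*n≡1 a) ⟩
      ι D ℚ.- 1ℚ               ≡⟨ cong (ℚ._- 1ℚ) (ι-+ 1 a) ⟩
      (1ℚ ℚ.+ ι a) ℚ.- 1ℚ      ≡⟨ cancel (ι a) ⟩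
      ι a                      ∎
      where
      open ≡-Reasoning
      open +-*-Solver
      distrib : ∀ u w → (1ℚ ℚ.- u) ℚ.* w ≡ w ℚ.- u ℚ.* w
      distrib = solve 2 (λ u w → (con 1ℚ :- u) :* w := w :- u :* w) refl
      cancel : ∀ x → (1ℚ ℚ.+ x) ℚ.- 1ℚ ≡ x
      cancel = solve 1 (λ x → (con 1ℚ :+ x) :- con 1ℚ := x) refl

    q*D≡1 : q ℚ.* ι D ≡ 1ℚ
    q*D≡1 = trans (double-complement u (ι D)) (1/n*n≡1 a)
      where
      open +-*-Solver
      double-complement : ∀ u w → (1ℚ ℚ.- (1ℚ ℚ.- u)) ℚ.* w ≡ u ℚ.* w
      double-complement = solve 2 (λ u w → (con 1ℚ :- (con 1ℚ :- u)) :* w := u :* w) refl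

  𝔼ℚ-ι : ∀ {N} (A : Subset N) (γ : Subset N → ℕ) → 𝔼ℚ A (ι ∘ γ) ℚ.* ι (D ^ ∣ A ∣) ≡ ι (𝔼 A γ)
  𝔼ℚ-ι []            γ = ℚ.*-identityʳ (ι (γ []))
  𝔼ℚ-ι (inside ∷ A)  γ = begin
    (p ℚ.* X ℚ.+ q ℚ.* Y) ℚ.* ι (D ℕ.* T)
      ≡⟨ cong ((p ℚ.* X ℚ.+ q ℚ.* Y) ℚ.*_) (ι-* D T) ⟩
    (p ℚ.* X ℚ.+ q ℚ.* Y) ℚ.* (ι D ℚ.* ι T)
      ≡⟨ regroup p q X Y (ι D) (ι T) ⟩
    (p ℚ.* ι D) ℚ.* (X ℚ.* ι T) ℚ.+ (q ℚ.* ι D) ℚ.* (Y ℚ.* ι T)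
      ≡⟨ cong₂ (λ x y → x ℚ.* (X ℚ.* ι T) ℚ.+ y ℚ.* (Y ℚ.* ι T)) p*D≡a q*D≡1 ⟩
    ι a ℚ.* (X ℚ.* ι T) ℚ.+ 1ℚ ℚ.* (Y ℚ.* ι T)
      ≡⟨ cong₂ (λ x y → ι a ℚ.* x ℚ.+ y) (𝔼ℚ-ι A (γ ∘ (inside ∷_))) (trans (ℚ.*-identityˡ _) (𝔼ℚ-ι A (γ ∘ (outside ∷_)))) ⟩
    ι a ℚ.* ι Eᵢ ℚ.+ ι Eₒ
      ≡⟨ trans (ι-+ (a ℕ.* Eᵢ) Eₒ) (cong (ℚ._+ ι Eₒ) (ι-* a Eᵢ)) ⟨
    ι (a ℕ.* Eᵢ ℕ.+ Eₒ) ∎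
    where
    open ≡-Reasoning
    T = D ^ ∣ A ∣
    X = 𝔼ℚ A (ι ∘ γ ∘ (inside ∷_))
    Y = 𝔼ℚ A (ι ∘ γ ∘ (outside ∷_))
    Eᵢ = 𝔼 A (γ ∘ (inside ∷_))
    Eₒ = 𝔼 A (γ ∘ (outside ∷_))
    regroup : ∀ p q X Y d t → (p ℚ.* X ℚ.+ q ℚ.* Y) ℚ.* (d ℚ.* t) ≡ (p ℚ.* d) ℚ.* (X ℚ.* t) ℚ.+ (q ℚ.* d) ℚ.* (Y ℚ.* t)
    regroup = solve 6 (λ p q X Y d t → (p :* X :+ q :* Y) :* (d :* t) := (p :* d) :* (X :* t) :+ (q :* d) :* (Y :* t)) refl
      where open +-*-Solver
  𝔼ℚ-ι (outside ∷ A) γ = 𝔼ℚ-ι A (γ ∘ (outside ∷_))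

private
  ι-pos : ∀ n .{{_ : ℕ.NonZero n}} → ℚ.Positive (ι n)
  ι-pos n = ℚ.normalize-pos n 1

  1/n-nonNeg : ∀ n → ℚ.NonNegative (+ 1 / suc n)
  1/n-nonNeg n = ℚ.normalize-nonNeg 1 (suc n)

  1/n*[n*x]≡x : ∀ n x → (+ 1 / suc n) ℚ.* (ι (suc n) ℚ.* x) ≡ x
  1/n*[n*x]≡x n x = trans (sym (ℚ.*-assoc (+ 1 / suc n) (ι (suc n)) x)) (trans (cong (ℚ._* x) (1/n*n≡1 n)) (ℚ.*-identityˡ x))

1/[1+d]≤ratio : ∀ d {X} g t .{{_ : ℕ.NonZero t}} → X ℚ.* ι t ≡ ι g → t ℕ.≤ suc d ℕ.* g → + 1 / suc d ℚ.≤ X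
1/[1+d]≤ratio d {X} g t X*t≡g t≤[1+d]g = ℚ.*-cancelʳ-≤-pos (ι t) {{ι-pos t}} (begin
  + 1 / suc d ℚ.* ι t                      ≤⟨ ℚ.*-monoˡ-≤-nonNeg (+ 1 / suc d) {{1/n-nonNeg d}} (ι-mono-≤ t≤[1+d]g) ⟩
  + 1 / suc d ℚ.* ι (suc d ℕ.* g)          ≡⟨ cong (+ 1 / suc d ℚ.*_) (ι-* (suc d) g) ⟩
  + 1 / suc d ℚ.* (ι (suc d) ℚ.* ι g)      ≡⟨ 1/n*[n*x]≡x d (ι g) ⟩
  ι g                                      ≡⟨ X*t≡g ⟨
  X ℚ.* ι t                                ∎)
  where open ℚ.≤-Reasoning

*1/[1+d]≤ : ∀ d {c m h} → c ℚ.≤ ι m → m ℕ.≤ suc d ℕ.* h → c ℚ.* (+ 1 / suc d) ℚ.≤ ι h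
*1/[1+d]≤ d {c} {m} {h} c≤m m≤[1+d]h = begin
  c ℚ.* (+ 1 / suc d)                       ≤⟨ ℚ.*-monoʳ-≤-nonNeg (+ 1 / suc d) {{1/n-nonNeg d}} c≤m ⟩
  ι m ℚ.* (+ 1 / suc d)                     ≤⟨ ℚ.*-monoʳ-≤-nonNeg (+ 1 / suc d) {{1/n-nonNeg d}} (ι-mono-≤ m≤[1+d]h) ⟩
  ι (suc d ℕ.* h) ℚ.* (+ 1 / suc d)         ≡⟨ ℚ.*-comm (ι (suc d ℕ.* h)) (+ 1 / suc d) ⟩
  + 1 / suc d ℚ.* ι (suc d ℕ.* h)           ≡⟨ cong (+ 1 / suc d ℚ.*_) (ι-* (suc d) h) ⟩
  + 1 / suc d ℚ.* (ι (suc d) ℚ.* ι h)       ≡⟨ 1/n*[n*x]≡x d (ι h) ⟩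
  ι h                                       ∎
  where open ℚ.≤-Reasoning

tail-bound : ∀ d c s x t .{{_ : NonZero s}} → d * c ≤ s → s * x ≤ c * t → d * x ≤ t
tail-bound d c s x t dc≤s sx≤ct = *-cancelˡ-≤ s (begin
  s * (d * x)    ≡⟨ x∙yz≈y∙xz s d x ⟩
  d * (s * x)    ≤⟨ *-monoʳ-≤ d sx≤ct ⟩
  d * (c * t)    ≡⟨ *-assoc d c t ⟨
  d * c * t      ≤⟨ *-monoˡ-≤ t dc≤s ⟩
  s * t          ∎)
  where open ≤-Reasoning

defect-tail : ∀ r m x E t .{{_ : NonZero r}} →
  suc m * x ≤ 4 * (8 * r) * E → 8 * r * (8 * r) * E ≤ m * (r * t) → 2 * x ≤ t
defect-tail r m x E t markov second-moment = *-cancelˡ-≤ (suc m) (begin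
  suc m * (2 * x)  ≤⟨ *-cancelˡ-≤ r (*-cancelˡ-≤ 4 (begin
    4 * (r * (suc m * (2 * x)))   ≡⟨ regroup₁ r (suc m) x ⟩
    8 * r * (suc m * x)           ≤⟨ *-monoʳ-≤ (8 * r) markov ⟩
    8 * r * (4 * (8 * r) * E)     ≡⟨ regroup₂ r E ⟩
    4 * (8 * r * (8 * r) * E)     ≤⟨ *-monoʳ-≤ 4 second-moment ⟩
    4 * (m * (r * t))             ≡⟨ cong (4 *_) (x∙yz≈y∙xz m r t) ⟩
    4 * (r * (m * t))             ∎)) ⟩
  m * t            ≤⟨ *-monoˡ-≤ t (n≤1+n m) ⟩
  suc m * t        ∎)
  where
  open ≤-Reasoning
  regroup₁ : ∀ r n x → 4 * (r * (n * (2 * x))) ≡ 8 * r * (n * x)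
  regroup₁ = solve-∀
  regroup₂ : ∀ r E → 8 * r * (4 * (8 * r) * E) ≡ 4 * (8 * r * (8 * r) * E)
  regroup₂ = solve-∀

tails⇒quarter : ∀ t g x y z → 32 * x ≤ t → 32 * y ≤ t → 2 * z ≤ t → t ≤ g + x + y + z → t ≤ 4 * g
tails⇒quarter t g x y z 32x≤t 32y≤t 2z≤t t≤sum = *-cancelˡ-≤ 14 (begin
  14 * t              ≤⟨ +-cancelʳ-≤ (18 * t) (14 * t) (32 * g) (begin
    14 * t + 18 * t                              ≡⟨ regroup₁ t ⟩
    32 * t                                       ≤⟨ *-monoʳ-≤ 32 t≤sum ⟩
    32 * (g + x + y + z)                         ≡⟨ regroup₂ g x y z ⟩
    32 * g + 32 * x + 32 * y + 16 * (2 * z)      ≤⟨ +-mono-≤ (+-mono-≤ (+-monoʳ-≤ (32 * g) 32x≤t) 32y≤t) (*-monoʳ-≤ 16 2z≤t) ⟩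
    32 * g + t + t + 16 * t                      ≡⟨ regroup₃ g t ⟩
    32 * g + 18 * t                              ∎) ⟩
  32 * g              ≤⟨ *-monoˡ-≤ g (m≤n+m 32 24) ⟩
  56 * g              ≡⟨ *-assoc 14 4 g ⟩
  14 * (4 * g)        ∎)
  where
  open ≤-Reasoning
  regroup₁ : ∀ t → 14 * t + 18 * t ≡ 32 * t
  regroup₁ = solve-∀
  regroup₂ : ∀ g x y z → 32 * (g + x + y + z) ≡ 32 * g + 32 * x + 32 * y + 16 * (2 * z)
  regroup₂ = solve-∀
  regroup₃ : ∀ g t → 32 * g + t + t + 16 * t ≡ 32 * g + 18 * t
  regroup₃ = solve-∀

h-lower : ∀ D m M H F → suc m ≤ 2 * (D * M) → M ≤ H + F → 4 * D * F ≤ m → m ≤ 4 * D * H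
h-lower D m M H F m<2DM M≤H+F 4DF≤m = +-cancelˡ-≤ m m (4 * D * H) (begin
  m + m                   ≤⟨ +-mono-≤ (n≤1+n m) (n≤1+n m) ⟩
  suc m + suc m           ≡⟨ cong (_+_ (suc m)) (+-identityʳ (suc m)) ⟨
  2 * suc m               ≤⟨ *-monoʳ-≤ 2 m<2DM ⟩
  2 * (2 * (D * M))       ≡⟨ regroup D M ⟩
  4 * D * M               ≤⟨ *-monoʳ-≤ (4 * D) M≤H+F ⟩
  4 * D * (H + F)         ≡⟨ *-distribˡ-+ (4 * D) H F ⟩
  4 * D * H + 4 * D * F   ≤⟨ +-monoʳ-≤ (4 * D * H) 4DF≤m ⟩
  4 * D * H + m           ≡⟨ +-comm (4 * D * H) m ⟩
  m + 4 * D * H           ∎)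
  where
  open ≤-Reasoning
  regroup : ∀ D M → 2 * (2 * (D * M)) ≡ 4 * D * M
  regroup = solve-∀

private
  k²≤[2DX]² : ∀ D k X → suc k ≤ 2 * (D * X) → k * k ≤ 4 * (D * D) * (X * X)
  k²≤[2DX]² D k X k<2DX = begin
    k * k                          ≤⟨ *-mono-≤ k≤2DX k≤2DX ⟩
    2 * (D * X) * (2 * (D * X))    ≡⟨ regroup D X ⟩
    4 * (D * D) * (X * X)          ∎
    where
    open ≤-Reasoning
    k≤2DX = ≤-trans (n≤1+n k) k<2DX
    regroup : ∀ D X → 2 * (D * X) * (2 * (D * X)) ≡ 4 * (D * D) * (X * X)
    regroup = solve-∀

X-large : ∀ D k X .{{_ : NonZero D}} → 4 * (D * D) ≤ k → suc k ≤ 2 * (D * X) → k ≤ X * X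
X-large D k X 4D²≤k k<2DX = *-cancelˡ-≤ (4 * (D * D)) {{m*n≢0 4 (D * D) {{_}} {{m*n≢0 D D}}}}
  (≤-trans (*-monoˡ-≤ k 4D²≤k) (k²≤[2DX]² D k X k<2DX))

f-small : ∀ D m k X F .{{_ : NonZero D}} → 4 * D * F ≤ m → 4 * (m * m) ≤ k → suc k ≤ 2 * (D * X) →
          4 * k * (F * F) ≤ X * X
f-small D m k X F 4DF≤m 4m²≤k k<2DX =
  ≤-trans (*-monoˡ-≤ (F * F) (*-monoˡ-≤ k (m≤m*n 4 4))) (*-cancelˡ-≤ (4 * (D * D)) {{m*n≢0 4 (D * D) {{_}} {{m*n≢0 D D}}}} (begin
    4 * (D * D) * (16 * k * (F * F))      ≡⟨ regroup₁ D k F ⟩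
    4 * k * (4 * D * F * (4 * D * F))     ≤⟨ *-monoʳ-≤ (4 * k) (*-mono-≤ 4DF≤m 4DF≤m) ⟩
    4 * k * (m * m)                       ≡⟨ regroup₂ k m ⟩
    k * (4 * (m * m))                     ≤⟨ *-monoʳ-≤ k 4m²≤k ⟩
    k * k                                 ≤⟨ k²≤[2DX]² D k X k<2DX ⟩
    4 * (D * D) * (X * X)                 ∎))
  where
  open ≤-Reasoning
  regroup₁ : ∀ D k F → 4 * (D * D) * (16 * k * (F * F)) ≡ 4 * k * (4 * D * F * (4 * D * F))
  regroup₁ = solve-∀
  regroup₂ : ∀ k m → 4 * k * (m * m) ≡ k * (4 * (m * m))
  regroup₂ = solve-∀

𝟙-cover : ∀ {P X Y Z : Set} (P? : Dec P) (X? : Dec X) (Y? : Dec Y) (Z? : Dec Z) → (¬ X → ¬ Y → ¬ Z → P) →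
          1 ≤ 𝟙 (does P?) + 𝟙 (does X?) + 𝟙 (does Y?) + 𝟙 (does Z?)
𝟙-cover (yes _) _       _       _       _ = s≤s z≤n
𝟙-cover (no _)  (yes _) _       _       _ = s≤s z≤n
𝟙-cover (no _)  (no _)  (yes _) _       _ = s≤s z≤n
𝟙-cover (no _)  (no _)  (no _)  (yes _) _ = s≤s z≤n
𝟙-cover (no ¬P) (no ¬X) (no ¬Y) (no ¬Z) P = contradiction (P ¬X ¬Y ¬Z) ¬P

4*8r≡32r : ∀ r₀ → 4 * suc (r₀ + 7 * suc r₀) ≡ suc (r₀ + 31 * suc r₀)
4*8r≡32r = solve-∀

32*4a≤1024r : ∀ r₀ → 32 * (4 * (r₀ + 7 * suc r₀)) ≤ 1024 * suc r₀
32*4a≤1024r r₀ = m+n≤o⇒m≤o (32 * (4 * (r₀ + 7 * suc r₀))) {128} (≤-reflexive (expand r₀))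
  where
  expand : ∀ r₀ → 32 * (4 * (r₀ + 7 * suc r₀)) + 128 ≡ 1024 * suc r₀
  expand = solve-∀

∸-to-ℤ-bound : ∀ k X {M H} → H ≤ M → 4 * k * ((M ∸ H) * (M ∸ H)) ≤ X * X →
  + (4 * k) ℤ.* ((+ M ℤ.- + H) ℤ.* (+ M ℤ.- + H)) ℤ.≤ + (X * X)
∸-to-ℤ-bound k X {M} {H} H≤M bound
  rewrite ℤ.m-n≡m⊖n M H | ℤ.⊖-≥ H≤M | sym (ℤ.pos-* (M ∸ H) (M ∸ H)) | sym (ℤ.pos-* (4 * k) ((M ∸ H) * (M ∸ H))) =
    ℤ.+≤+ bound

module Setting
  (r₀ k ℓ : ℕ) (G : Hypergraph) (rank : All (λ e → ∣ e ∣ ≤ suc r₀) (edges G))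
  (c : ℚ) (1024r≤c : (+ (32 * 32 * suc r₀) / 1) ≤ℚ c)
  (A : Subset (n G)) (∣A∣≡k : ∣ A ∣ ≡ k) (eA≡ℓ : e G A ≡ ℓ)
  (c≤m : c ≤ℚ (+ m G A / 1)) (4m²≤k : LeHalfSqrt (m G A) k) where

  r = suc r₀

  -- D = a + 1 = 8r, so that p = a/D = 1 - 1/(8r).
  a = r₀ + 7 * r

  open SubsetSum a
  open Defect G A

  T = D ^ ∣ A ∣
  z = zOf r c

  1024r≤m : 1024 * r ≤ m G A
  1024r≤m = ι-cancel-≤ (ℚ.≤-trans 1024r≤c c≤m)

  instance
    m≢0 : NonZero (m G A)
    m≢0 = >-nonZero (≤-trans (s≤s z≤n) 1024r≤m)

  m≤k : m G A ≤ k
  m≤k = ≤-trans (m≤m*n (m G A) (m G A)) (≤-trans (m≤n*m (m G A * m G A) 4) 4m²≤k)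

  module Missing = LowerTail a A (lookup A) (λ _ v∈A → v∈A)
  module MissingNonIsolated = LowerTail a A (does ∘ nonIsolated? G A) (nonIsolated⇒∈ G A)

  Missing-s≡k : Missing.s ≡ k
  Missing-s≡k = trans (sym (∣p∣≡sum A)) ∣A∣≡k

  Missing-X≡∣A─B∣ : ∀ B → Missing.X B ≡ ∣ A ─ B ∣
  Missing-X≡∣A─B∣ B = sym (∣p─q∣≡sum A B)

  MissingNonIsolated-s≡m : MissingNonIsolated.s ≡ m G A
  MissingNonIsolated-s≡m = sym (m≡sum G A)

  MissingNonIsolated-X≡mAB : ∀ B → MissingNonIsolated.X B ≡ mAB G A B
  MissingNonIsolated-X≡mAB B = sym (mAB≡sum G A B)

  nice-unless-bad : ∀ {B} → B ⊆ A → suc k ≤ 2 * (D * ∣ A ─ B ∣) → suc (m G A) ≤ 2 * (D * mAB G A B) →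
                    4 * D * defect B ≤ m G A → Nice G k ℓ z A B
  nice-unless-bad {B} B⊆A many-missing many-missing-nonIsolated small-defect =
    (∣A∣≡k , eA≡ℓ) , (z≤h , 4h²≤k) , inj₂ 4kf²≤X² , k≤X²
    where
    X = ∣ A ─ B ∣
    M = mAB G A B
    H = h G A B
    F = M ∸ H
    H≤M : H ≤ M
    H≤M = h≤mAB G A B⊆A
    4DF≤m : 4 * D * F ≤ m G A
    4DF≤m = ≤-trans (*-monoʳ-≤ (4 * D) (m≤n+o⇒m∸n≤o M H (mAB≤h+defect G A B))) small-defect
    z≤h : z ≤ℚ (+ H / 1)
    z≤h = *1/[1+d]≤ (r₀ + 31 * r) c≤m (subst (λ x → m G A ≤ x * H) (4*8r≡32r r₀)
            (h-lower D (m G A) M H (defect B) many-missing-nonIsolated (mAB≤h+defect G A B) small-defect))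
    4h²≤k : LeHalfSqrt H k
    4h²≤k = ≤-trans (*-monoʳ-≤ 4 (*-mono-≤ H≤m H≤m)) 4m²≤k
      where H≤m = ≤-trans H≤M (mAB≤m G A B)
    4kf²≤X² : + (4 * k) ℤ.* (f G A B ℤ.* f G A B) ℤ.≤ + (X * X)
    4kf²≤X² = ∸-to-ℤ-bound k X H≤M (f-small D (m G A) k X F 4DF≤m 4m²≤k many-missing)
    k≤X² : SqrtLe k X
    k≤X² = X-large D k X (≤-trans (*-monoʳ-≤ 4 (*-mono-≤ D≤m D≤m)) 4m²≤k) many-missing
      where D≤m = ≤-trans (*-monoˡ-≤ r (m≤m+n 8 1016)) 1024r≤m

  nice large-defect : Subset (n G) → ℕ
  nice         B = 𝟙 (does (nice? G k ℓ z A B))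
  large-defect B = 𝟙 (does (suc (m G A) ≤? 4 * D * defect B))

  nice-or-bad : ∀ B → B ⊆ A → 1 ≤ nice B + Missing.few B + MissingNonIsolated.few B + large-defect B
  nice-or-bad B B⊆A =
    𝟙-cover (nice? G k ℓ z A B) (2 * (D * Missing.X B) ≤? Missing.s)
            (2 * (D * MissingNonIsolated.X B) ≤? MissingNonIsolated.s) (suc (m G A) ≤? 4 * D * defect B)
      λ ¬few ¬few-nonIsolated ¬large → nice-unless-bad B⊆A
        (subst₂ (λ s x → suc s ≤ 2 * (D * x)) Missing-s≡k (Missing-X≡∣A─B∣ B) (≰⇒> ¬few))
        (subst₂ (λ s x → suc s ≤ 2 * (D * x)) MissingNonIsolated-s≡m (MissingNonIsolated-X≡mAB B) (≰⇒> ¬few-nonIsolated))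
        (≮⇒≥ ¬large)

  T≤good+bad : T ≤ 𝔼 A nice + 𝔼 A Missing.few + 𝔼 A MissingNonIsolated.few + 𝔼 A large-defect
  T≤good+bad = begin
    T                ≡⟨ 𝔼-one A ⟨
    𝔼 A (λ _ → 1)    ≤⟨ 𝔼-mono A nice-or-bad ⟩
    𝔼 A (λ B → nice B + Missing.few B + MissingNonIsolated.few B + large-defect B)
      ≡⟨ 𝔼-+ A (λ B → nice B + Missing.few B + MissingNonIsolated.few B) large-defect ⟩
    𝔼 A (λ B → nice B + Missing.few B + MissingNonIsolated.few B) + 𝔼 A large-defect
      ≡⟨ cong (_+ 𝔼 A large-defect) (trans (𝔼-+ A (λ B → nice B + Missing.few B) MissingNonIsolated.few)
                                          (cong (_+ 𝔼 A MissingNonIsolated.few) (𝔼-+ A nice Missing.few))) ⟩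
    𝔼 A nice + 𝔼 A Missing.few + 𝔼 A MissingNonIsolated.few + 𝔼 A large-defect ∎
    where open ≤-Reasoning

  32*4a≤m : 32 * (4 * a) ≤ m G A
  32*4a≤m = ≤-trans (32*4a≤1024r r₀) 1024r≤m

  few-missing-rare : 32 * 𝔼 A Missing.few ≤ T
  few-missing-rare = tail-bound 32 (4 * a) k _ T {{>-nonZero (≤-trans (s≤s z≤n) (≤-trans 1024r≤m m≤k))}}
    (≤-trans 32*4a≤m m≤k) (subst (λ s → s * 𝔼 A Missing.few ≤ 4 * a * T) Missing-s≡k Missing.lower-tail)

  few-missing-nonIsolated-rare : 32 * 𝔼 A MissingNonIsolated.few ≤ T
  few-missing-nonIsolated-rare = tail-bound 32 (4 * a) (m G A) _ T 32*4a≤m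
    (subst (λ s → s * 𝔼 A MissingNonIsolated.few ≤ 4 * a * T) MissingNonIsolated-s≡m MissingNonIsolated.lower-tail)

  large-defect-rare : 2 * 𝔼 A large-defect ≤ T
  large-defect-rare = defect-tail r (m G A) _ (𝔼 A defect) T
    (≤-trans (markov A (suc (m G A)) (λ B → 4 * D * defect B)) (≤-reflexive (𝔼-* A (4 * D) defect)))
    (𝔼-defect a G A rank)

  prob*T≡good : prob (pOf r) A (nice? G k ℓ z A) ℚ.* ι T ≡ ι (𝔼 A nice)
  prob*T≡good = trans (cong (ℚ._* ι T) (prob≡𝔼ℚ A (nice? G k ℓ z A))) (𝔼ℚ-ι A nice)
    where open BinomialExpectation a using (prob≡𝔼ℚ; 𝔼ℚ-ι)

-- Only c ≥ 1024r, c ≤ m(A) and 4m(A)² ≤ k are used.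
lemma5p3 : (r k ℓ : ℕ) → 1 ≤ r → 1 ≤ k → 1 ≤ ℓ →
  (G : Hypergraph) → k ≤ n G → All (λ ed → ∣ ed ∣ ≤ r) (edges G) →
  (c : ℚ) → (+ (32 * 32 * r) / 1) ≤ℚ c → LtHalfSqrtℚ c k →
  (A : Subset (n G)) → ∣ A ∣ ≡ k → e G A ≡ ℓ →
  c ≤ℚ (+ m G A / 1) → LeHalfSqrt (m G A) k →
  (+ 1 / 4) ≤ℚ prob (pOf r) A (nice? G k ℓ (zOf r c) A)
lemma5p3 (suc r₀) k ℓ _ _ _ G _ rank c 1024r≤c _ A ∣A∣≡k eA≡ℓ c≤m 4m²≤k =
  1/[1+d]≤ratio 3 (𝔼 A nice) T {{m^n≢0 D ∣ A ∣}} prob*T≡good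
    (tails⇒quarter T (𝔼 A nice) (𝔼 A Missing.few) (𝔼 A MissingNonIsolated.few) (𝔼 A large-defect)
      few-missing-rare few-missing-nonIsolated-rare large-defect-rare T≤good+bad)
  where
  open Setting r₀ k ℓ G rank c 1024r≤c A ∣A∣≡k eA≡ℓ c≤m 4m²≤k
  open SubsetSum a using (D; 𝔼)
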